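{- Let $\Sigma$ be a many-typed signature, $\Gamma$ a context, $\tau$ a type, and $\Gamma\vdash t:\tau$ a term. Then $\Gamma\vdash\ \downarrow^{\mathrm{nf}}_\tau(\mathrm{nf}_{\Gamma,\tau}(t))=t:\tau$.
   Context: A many-typed signature $\Sigma=(S,O)$ consists of a set $S$ of atomic types and operation symbols $\vartheta$ with arities $O(\vartheta)=(\Delta,\tau)$ ($\Delta$ a list of types, $\tau$ a type). Simple types are generated from $S$ by $\times,\to$; contexts are finite lists of types. Syntax: terms $\Gamma\vdash t:\tau$ and substitutions $\Gamma\vdash\delta:\Delta$ generated by the last variable $\mathrm{v}$, operations $\Delta\vdash\vartheta:\tau$, explicit substitution $t[\delta]$, $\lambda$, application, pairs, projections $t.1,t.2$, and substitutions $\mathrm{id}$, weakening $\mathrm{p}$, extension $(\delta,t)$, composition; quotiented by the congruence generated by $\beta\eta$ for functions and pairs, category laws, $\mathrm{p}\circ(\delta,t)=\delta$, $(\xi,t)\circ\delta=(\xi\circ\delta,t[\delta])$, $\mathrm{v}[(\delta,t)]=t$, $\mathrm{v}[\mathrm{id}]=\mathrm{v}$, and substitution commuting with term formers; "$\Gamma\vdash s=t:\tau$" denotes this definitional equality. $\mathrm{Cl}(\Sigma)$: contexts and equivalence classes of substitutions (the free $\lambda$-theory on $\Sigma$). $\mathrm{Ren}(\Sigma)$: contexts and type-preserving variable renamings, $i:\mathrm{Ren}(\Sigma)\to\mathrm{Cl}(\Sigma)$ the inclusion; $\mathrm{TM}(\Delta)=\mathrm{Hom}_{\mathrm{Cl}(\Sigma)}(i(-),\Delta)$,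 a presheaf on $\mathrm{Ren}(\Sigma)$. Neutrals: variables, $\vartheta[\delta]$ ($\delta$ normal substitution), $t(s)$ ($t$ neutral, $s$ normal), $t.1,t.2$; normals: neutrals at atomic type, $\lambda^\sigma.t$, pairs; substitutions are tuples. $\mathrm{NE}_\tau,\mathrm{NF}_\tau$ (and $\mathrm{NE}_\Gamma,\mathrm{NF}_\Gamma$ for contexts) are the presheaves of these unquotiented syntactic forms; $\downarrow^{\mathrm{ne}},\downarrow^{\mathrm{nf}}$ map them to their equivalence classes in $\mathrm{TM}$. $\mathrm{id}_\Gamma\in\mathrm{NE}_\Gamma(\Gamma)$ is the tuple of all variables of $\Gamma$. Presheaves $P_\tau$, maps $\mathrm{reflect}_\tau:\mathrm{NE}_\tau\to P_\tau$, $\mathrm{reify}_\tau:P_\tau\to\mathrm{NF}_\tau$: atomic $P_\tau=\mathrm{NF}_\tau$ (reflect = inclusion, reify = identity); $P_{\sigma\times\tau}=P_\sigma\times P_\tau$ componentwise; $P_{\sigma\to\tau}$ the pullback of $F\mapsto\lambda v.\downarrow^{\mathrm{nf}}\mathrm{reify}_\tau(Fv)$ and $t\mapsto\lambda v.t(\downarrow^{\mathrm{nf}}\mathrm{reify}_\sigma v)$ into $\mathrm{TM}(\tau)^{P_\sigma}$, elements pairs $(t,F)$, $\mathrm{reflect}(t)=(\downarrow^{\mathrm{ne}}t,\lambda v.\mathrm{reflect}_\tau(t(\mathrm{reify}_\sigma v)))$, $\mathrm{reify}(t,F)=\lambda^\sigma.\mathrm{reify}_\tau(F(\mathrm{reflect}_\sigma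 x))$, $x$ the fresh variable; contexts: $P_{[\,]}=1$, $P_{\Gamma,\tau}=P_\Gamma\times P_\tau$ componentwise. Gluing category $\mathrm{Gl}(\Sigma)=\mathrm{id}\downarrow\mathrm{TM}$: objects $(\mathcal D,\Delta,q:\mathcal D\to\mathrm{TM}(\Delta))$, morphisms pairs $(d,\delta)$ with $q_\Delta\circ d=\mathrm{TM}(\delta)\circ q_\Gamma$. It is cartesian closed with $[\![\tau]\!]=(P_\tau,\tau,\downarrow^{\mathrm{nf}}\circ\mathrm{reify}_\tau)$ (similarly for contexts) realizing products and exponentials; $[\![-]\!]:\mathrm{Cl}(\Sigma)\to\mathrm{Gl}(\Sigma)$ is the induced structure-preserving interpretation functor (each operation $\vartheta$ interpreted by a $\mathrm{Gl}$-morphism whose $\mathrm{Cl}$-component is $\vartheta$). The normalization function $\mathrm{nf}_{\Gamma,\Delta}:\mathrm{Hom}_{\mathrm{Cl}(\Sigma)}(\Gamma,\Delta)\to\mathrm{NF}_\Delta(\Gamma)$ is: given $\delta$, write $[\![\delta]\!]=(d,\delta')$ with $d:P_\Gamma\to P_\Delta$, and set $\mathrm{nf}_{\Gamma,\Delta}(\delta)=(\mathrm{reify}_\Delta)_\Gamma\big(d_\Gamma((\mathrm{reflect}_\Gamma)_\Gamma(\mathrm{id}_\Gamma))\big)$. -}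

module Defs where

open import Data.Unit using (⊤; tt)
open import Data.Product using (_×_; _,_; proj₁; proj₂)

infixr 30 _⇒_
infixr 35 _⊗_
infixl 25 _▹_

data Ty (S : Set) : Set where
  ι   : S → Ty S
  _⊗_ : Ty S → Ty S → Ty S
  _⇒_ : Ty S → Ty S → Ty S

data Ctx (S : Set) : Set where
  ε   : Ctx S
  _▹_ : Ctx S → Ty S → Ctx S

record Signature : Set₁ where
  field
    S   : Set
    O   : Set
    dom : O → Ctx S
    cod : O → Ty S

module _ (Σ : Signature) where
  open Signature Σ

  private
    variable
      Γ Δ Θ Ξ : Ctx S
      σ τ : Ty S

  infixl 40 _[_]
  infixr 45 _∘ₛ_
  infixl 20 _,ₛ_

  data Tm : Ctx S → Ty S → Set
  data Sub : Ctx S → Ctx S → Set   -- Sub Γ Δ :  Γ ⊢ δ : Δ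

  data Tm where
    v    : Tm (Γ ▹ τ) τ
    op   : (o : O) → Tm (dom o) (cod o)
    _[_] : Tm Δ τ → Sub Γ Δ → Tm Γ τ
    lam  : Tm (Γ ▹ σ) τ → Tm Γ (σ ⇒ τ)
    app  : Tm Γ (σ ⇒ τ) → Tm Γ σ → Tm Γ τ
    pair : Tm Γ σ → Tm Γ τ → Tm Γ (σ ⊗ τ)
    fst  : Tm Γ (σ ⊗ τ) → Tm Γ σ
    snd  : Tm Γ (σ ⊗ τ) → Tm Γ τ

  data Sub where
    id    : Sub Γ Γ
    p     : Sub (Γ ▹ τ) Γ
    ⟨⟩    : Sub Γ ε
    _,ₛ_  : Sub Γ Δ → Tm Γ τ → Sub Γ (Δ ▹ τ)
    _∘ₛ_  : Sub Δ Θ → Sub Γ Δ → Sub Γ Θ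

  infix 4 _≈_ _≈ₛ_

  data _≈_ : Tm Γ τ → Tm Γ τ → Set
  data _≈ₛ_ : Sub Γ Δ → Sub Γ Δ → Set

  data _≈_ where
    refl≈  : {t : Tm Γ τ} → t ≈ t
    sym≈   : {t u : Tm Γ τ} → t ≈ u → u ≈ t
    trans≈ : {t u w : Tm Γ τ} → t ≈ u → u ≈ w → t ≈ w
    []-cong   : {t t' : Tm Δ τ} {δ δ' : Sub Γ Δ} → t ≈ t' → δ ≈ₛ δ' → t [ δ ] ≈ t' [ δ' ]
    lam-cong  : {t t' : Tm (Γ ▹ σ) τ} → t ≈ t' → lam t ≈ lam t'
    app-cong  : {t t' : Tm Γ (σ ⇒ τ)} {s s' : Tm Γ σ} → t ≈ t' → s ≈ s' → app t s ≈ app t' s'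
    pair-cong : {a a' : Tm Γ σ} {b b' : Tm Γ τ} → a ≈ a' → b ≈ b' → pair a b ≈ pair a' b'
    fst-cong  : {t t' : Tm Γ (σ ⊗ τ)} → t ≈ t' → fst t ≈ fst t'
    snd-cong  : {t t' : Tm Γ (σ ⊗ τ)} → t ≈ t' → snd t ≈ snd t'
    ⇒β : (t : Tm (Γ ▹ σ) τ) (s : Tm Γ σ) → app (lam t) s ≈ t [ id ,ₛ s ]
    ⇒η : (t : Tm Γ (σ ⇒ τ)) → t ≈ lam (app (t [ p ]) v)
    ⊗β₁ : (a : Tm Γ σ) (b : Tm Γ τ) → fst (pair a b) ≈ a
    ⊗β₂ : (a : Tm Γ σ) (b : Tm Γ τ) → snd (pair a b) ≈ b
    ⊗η  : (t : Tm Γ (σ ⊗ τ)) → t ≈ pair (fst t) (snd t)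
    [id] : (t : Tm Γ τ) → t [ id ] ≈ t
    [∘]  : (t : Tm Θ τ) (δ : Sub Δ Θ) (ξ : Sub Γ Δ) → t [ δ ] [ ξ ] ≈ t [ δ ∘ₛ ξ ]
    v[,]  : (δ : Sub Γ Δ) (t : Tm Γ τ) → v [ δ ,ₛ t ] ≈ t
    v[id] : v {Γ} {τ} [ id ] ≈ v
    lam[] : (t : Tm (Δ ▹ σ) τ) (δ : Sub Γ Δ) → (lam t) [ δ ] ≈ lam (t [ (δ ∘ₛ p) ,ₛ v ])
    app[] : (t : Tm Δ (σ ⇒ τ)) (s : Tm Δ σ) (δ : Sub Γ Δ) → (app t s) [ δ ] ≈ app (t [ δ ]) (s [ δ ])
    pair[] : (a : Tm Δ σ) (b : Tm Δ τ) (δ : Sub Γ Δ) → (pair a b) [ δ ] ≈ pair (a [ δ ]) (b [ δ ])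
    fst[] : (t : Tm Δ (σ ⊗ τ)) (δ : Sub Γ Δ) → (fst t) [ δ ] ≈ fst (t [ δ ])
    snd[] : (t : Tm Δ (σ ⊗ τ)) (δ : Sub Γ Δ) → (snd t) [ δ ] ≈ snd (t [ δ ])

  data _≈ₛ_ where
    refl≈ₛ  : {δ : Sub Γ Δ} → δ ≈ₛ δ
    sym≈ₛ   : {δ ξ : Sub Γ Δ} → δ ≈ₛ ξ → ξ ≈ₛ δ
    trans≈ₛ : {δ ξ ζ : Sub Γ Δ} → δ ≈ₛ ξ → ξ ≈ₛ ζ → δ ≈ₛ ζ
    ,-cong  : {δ δ' : Sub Γ Δ} {t t' : Tm Γ τ} → δ ≈ₛ δ' → t ≈ t' → (δ ,ₛ t) ≈ₛ (δ' ,ₛ t')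
    ∘-cong  : {δ δ' : Sub Δ Θ} {ξ ξ' : Sub Γ Δ} → δ ≈ₛ δ' → ξ ≈ₛ ξ' → δ ∘ₛ ξ ≈ₛ δ' ∘ₛ ξ'
    idl   : (δ : Sub Γ Δ) → id ∘ₛ δ ≈ₛ δ
    idr   : (δ : Sub Γ Δ) → δ ∘ₛ id ≈ₛ δ
    assoc : (δ : Sub Θ Ξ) (ξ : Sub Δ Θ) (ζ : Sub Γ Δ) → (δ ∘ₛ ξ) ∘ₛ ζ ≈ₛ δ ∘ₛ (ξ ∘ₛ ζ)
    p∘,   : (δ : Sub Γ Δ) (t : Tm Γ τ) → p ∘ₛ (δ ,ₛ t) ≈ₛ δ
    ,∘    : (ξ : Sub Δ Θ) (t : Tm Δ τ) (δ : Sub Γ Δ) → (ξ ,ₛ t) ∘ₛ δ ≈ₛ (ξ ∘ₛ δ) ,ₛ t [ δ ]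
    ,η    : (δ : Sub Γ (Δ ▹ τ)) → δ ≈ₛ (p ∘ₛ δ) ,ₛ v [ δ ]
    εη    : (δ : Sub Γ ε) → δ ≈ₛ ⟨⟩

  data Var : Ctx S → Ty S → Set where
    vz : Var (Γ ▹ τ) τ
    vs : Var Γ τ → Var (Γ ▹ σ) τ

  -- Ren Γ Δ : a renaming Γ → Δ, i.e. a tuple of variables of Γ, one for each entry of Δ
  data Ren : Ctx S → Ctx S → Set where
    ε   : Ren Γ ε
    _,ᵣ_ : Ren Γ Δ → Var Γ τ → Ren Γ (Δ ▹ τ)

  renVar : Ren Γ Δ → Var Δ τ → Var Γ τ
  renVar (ρ ,ᵣ x) vz     = x
  renVar (ρ ,ᵣ x) (vs y) = renVar ρ y

  wkRen : Ren Γ Δ → Ren (Γ ▹ σ) Δ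
  wkRen ε        = ε
  wkRen (ρ ,ᵣ x) = wkRen ρ ,ᵣ vs x

  idRen : Ren Γ Γ
  idRen {ε}     = ε
  idRen {Γ ▹ τ} = wkRen idRen ,ᵣ vz

  wk : Ren (Γ ▹ σ) Γ
  wk = wkRen idRen

  _∘ᵣ_ : Ren Γ Δ → Ren Θ Γ → Ren Θ Δ
  ε        ∘ᵣ ρ' = ε
  (ρ ,ᵣ x) ∘ᵣ ρ' = (ρ ∘ᵣ ρ') ,ᵣ renVar ρ' x

  ⌜_⌝v : Var Γ τ → Tm Γ τ
  ⌜ vz ⌝v   = v
  ⌜ vs x ⌝v = ⌜ x ⌝v [ p ]

  ⌜_⌝r : Ren Γ Δ → Sub Γ Δ
  ⌜ ε ⌝r      = ⟨⟩
  ⌜ ρ ,ᵣ x ⌝r = ⌜ ρ ⌝r ,ₛ ⌜ x ⌝v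

  data Ne  : Ctx S → Ty S → Set
  data Nf  : Ctx S → Ty S → Set
  data NfS : Ctx S → Ctx S → Set   -- NF_Δ(Γ) = NfS Γ Δ : tuples of normal forms

  data Ne where
    var  : Var Γ τ → Ne Γ τ
    opN  : (o : O) → NfS Γ (dom o) → Ne Γ (cod o)
    appN : Ne Γ (σ ⇒ τ) → Nf Γ σ → Ne Γ τ
    fstN : Ne Γ (σ ⊗ τ) → Ne Γ σ
    sndN : Ne Γ (σ ⊗ τ) → Ne Γ τ

  data Nf where
    neN   : {a : S} → Ne Γ (ι a) → Nf Γ (ι a)
    lamN  : Nf (Γ ▹ σ) τ → Nf Γ (σ ⇒ τ)
    pairN : Nf Γ σ → Nf Γ τ → Nf Γ (σ ⊗ τ)

  data NfS where
    ε    : NfS Γ ε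
    _,ₙ_ : NfS Γ Δ → Nf Γ τ → NfS Γ (Δ ▹ τ)

  -- NE_Δ(Γ) = NeS Γ Δ : tuples of neutrals
  data NeS : Ctx S → Ctx S → Set where
    ε    : NeS Γ ε
    _,ₙ_ : NeS Γ Δ → Ne Γ τ → NeS Γ (Δ ▹ τ)

  renToNe : Ren Γ Δ → NeS Γ Δ
  renToNe ε        = ε
  renToNe (ρ ,ᵣ x) = renToNe ρ ,ₙ var x

  idNe : NeS Γ Γ
  idNe = renToNe idRen

  renNe  : Ren Δ Γ → Ne Γ τ → Ne Δ τ
  renNf  : Ren Δ Γ → Nf Γ τ → Nf Δ τ
  renNfS : Ren Δ Γ → NfS Γ Θ → NfS Δ Θ

  renNe ρ (var x)    = var (renVar ρ x)
  renNe ρ (opN o ns) = opN o (renNfS ρ ns)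
  renNe ρ (appN n m) = appN (renNe ρ n) (renNf ρ m)
  renNe ρ (fstN n)   = fstN (renNe ρ n)
  renNe ρ (sndN n)   = sndN (renNe ρ n)

  renNf ρ (neN n)     = neN (renNe ρ n)
  renNf ρ (lamN m)    = lamN (renNf (wkRen ρ ,ᵣ vz) m)
  renNf ρ (pairN a b) = pairN (renNf ρ a) (renNf ρ b)

  renNfS ρ ε         = ε
  renNfS ρ (ns ,ₙ n) = renNfS ρ ns ,ₙ renNf ρ n

  ↓ne  : Ne Γ τ → Tm Γ τ
  ↓nf  : Nf Γ τ → Tm Γ τ
  ↓nfS : NfS Γ Δ → Sub Γ Δ

  ↓ne (var x)    = ⌜ x ⌝v
  ↓ne (opN o ns) = op o [ ↓nfS ns ]
  ↓ne (appN n m) = app (↓ne n) (↓nf m)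
  ↓ne (fstN n)   = fst (↓ne n)
  ↓ne (sndN n)   = snd (↓ne n)

  ↓nf (neN n)     = ↓ne n
  ↓nf (lamN m)    = lam (↓nf m)
  ↓nf (pairN a b) = pair (↓nf a) (↓nf b)

  ↓nfS ε         = ⟨⟩
  ↓nfS (ns ,ₙ n) = ↓nfS ns ,ₛ ↓nf n

  P : Ty S → Ctx S → Set
  P (ι a)   Γ = Nf Γ (ι a)
  P (σ ⊗ τ) Γ = P σ Γ × P τ Γ
  P (σ ⇒ τ) Γ = Tm Γ (σ ⇒ τ) × (∀ {Δ} → Ren Δ Γ → P σ Δ → P τ Δ)

  renP : (τ : Ty S) → Ren Δ Γ → P τ Γ → P τ Δ
  renP (ι a)   ρ n       = renNf ρ n
  renP (σ ⊗ τ) ρ (a , b) = renP σ ρ a , renP τ ρ b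
  renP (σ ⇒ τ) ρ (t , F) = t [ ⌜ ρ ⌝r ] , (λ ρ' → F (ρ ∘ᵣ ρ'))

  reflect : (τ : Ty S) → Ne Γ τ → P τ Γ
  reify   : (τ : Ty S) → P τ Γ → Nf Γ τ

  reflect (ι a)   n = neN n
  reflect (σ ⊗ τ) n = reflect σ (fstN n) , reflect τ (sndN n)
  reflect (σ ⇒ τ) n = ↓ne n , (λ ρ a → reflect τ (appN (renNe ρ n) (reify σ a)))

  reify (ι a)   n       = n
  reify (σ ⊗ τ) (a , b) = pairN (reify σ a) (reify τ b)
  reify (σ ⇒ τ) (t , F) = lamN (reify τ (F wk (reflect σ (var vz))))

  PC : Ctx S → Ctx S → Set
  PC ε       Δ = ⊤
  PC (Γ ▹ τ) Δ = PC Γ Δ × P τ Δ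

  renPC : (Γ : Ctx S) → Ren Θ Δ → PC Γ Δ → PC Γ Θ
  renPC ε       ρ tt      = tt
  renPC (Γ ▹ τ) ρ (γ , a) = renPC Γ ρ γ , renP τ ρ a

  reflectC : (Γ : Ctx S) → NeS Δ Γ → PC Γ Δ
  reflectC ε       ε         = tt
  reflectC (Γ ▹ τ) (ns ,ₙ n) = reflectC Γ ns , reflect τ n

  reifyC : (Γ : Ctx S) → PC Γ Δ → NfS Δ Γ
  reifyC ε       tt      = ε
  reifyC (Γ ▹ τ) (γ , a) = reifyC Γ γ ,ₙ reify τ a

  -- First (presheaf) component d of the interpretation [[-]] : Cl(Σ) → Gl(Σ).
  -- Operations ϑ are interpreted by d(γ) = reflect (ϑ[reify γ]).

  eval  : Tm Γ τ → PC Γ Δ → P τ Δ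
  evalS : Sub Γ Θ → PC Γ Δ → PC Θ Δ

  eval {τ = τ} v          (γ , a) = a
  eval (op o)     γ       = reflect (cod o) (opN o (reifyC (dom o) γ))
  eval (t [ δ ])  γ       = eval t (evalS δ γ)
  eval {Γ = Γ} (lam t) γ  =
    lam t [ ↓nfS (reifyC Γ γ) ] , (λ ρ a → eval t (renPC Γ ρ γ , a))
  eval (app t s)  γ       = proj₂ (eval t γ) idRen (eval s γ)
  eval (pair a b) γ       = eval a γ , eval b γ
  eval (fst t)    γ       = proj₁ (eval t γ)
  eval (snd t)    γ       = proj₂ (eval t γ)

  evalS id       γ       = γ
  evalS p        (γ , a) = γ
  evalS ⟨⟩       γ       = tt
  evalS (δ ,ₛ t) γ       = evalS δ γ , eval t γ
  evalS (δ ∘ₛ ξ) γ       = evalS δ (evalS ξ γ)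

  nf : (Γ : Ctx S) (τ : Ty S) → Tm Γ τ → Nf Γ τ
  nf Γ τ t = reify τ (eval t (reflectC Γ idNe))

  nfS : (Γ Δ : Ctx S) → Sub Γ Δ → NfS Γ Δ
  nfS Γ Δ δ = reifyC Δ (evalS δ (reflectC Γ idNe))

-- A Kripke logical relation between terms t : Tm Γ τ and semantic values a : P τ Γ is
-- closed under definitional equality and renaming.  Reflecting a neutral n yields a value
-- related to ↓ne n, and a value related to t reifies to a normal form equal to t; at
-- function and product types these two facts feed each other through η.  The fundamental
-- lemma relates t [ δ ] to eval t γ whenever δ and γ are related; applying it to the
-- identity substitution and the reflected identity environment and then reifying gives the result.
module Submission where

open import Defs
open import Data.Unit using (⊤; tt)
open import Data.Product using (_×_; _,_; proj₁; proj₂)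
open import Relation.Binary.Bundles using (Setoid)
import Relation.Binary.Reasoning.Setoid as SetoidReasoning

module Soundness (Σ : Signature) where
  open Signature Σ

  private
    variable
      Γ Δ Θ : Ctx S
      σ τ : Ty S

  infix 4 _≈'_ _≈ₛ'_
  infixr 5 _∙_ _∙ₛ_

  _≈'_ : Tm Σ Γ τ → Tm Σ Γ τ → Set
  _≈'_ = _≈_ Σ

  _≈ₛ'_ : Sub Σ Γ Δ → Sub Σ Γ Δ → Set
  _≈ₛ'_ = _≈ₛ_ Σ

  _∙_ : {t u w : Tm Σ Γ τ} → t ≈' u → u ≈' w → t ≈' w
  _∙_ = trans≈

  _∙ₛ_ : {δ ξ ζ : Sub Σ Γ Δ} → δ ≈ₛ' ξ → ξ ≈ₛ' ζ → δ ≈ₛ' ζ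
  _∙ₛ_ = trans≈ₛ

  Tm-setoid : Ctx S → Ty S → Setoid _ _
  Tm-setoid Γ τ = record
    { Carrier       = Tm Σ Γ τ
    ; _≈_           = _≈'_
    ; isEquivalence = record { refl = refl≈ ; sym = sym≈ ; trans = trans≈ }
    }

  module ≈-Reasoning {Γ} {τ} = SetoidReasoning (Tm-setoid Γ τ)

  ⌜_⌝V : Var Σ Γ τ → Tm Σ Γ τ
  ⌜_⌝V = ⌜_⌝v Σ

  ⌜_⌝R : Ren Σ Γ Δ → Sub Σ Γ Δ
  ⌜_⌝R = ⌜_⌝r Σ

  ⌜renVar⌝ : (ρ : Ren Σ Γ Δ) (x : Var Σ Δ τ) → ⌜ renVar Σ ρ x ⌝V ≈' ⌜ x ⌝V [ ⌜ ρ ⌝R ]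
  ⌜renVar⌝ (ρ ,ᵣ y) vz     = sym≈ (v[,] _ _)
  ⌜renVar⌝ (ρ ,ᵣ y) (vs x) =
    ⌜renVar⌝ ρ x ∙ []-cong refl≈ (sym≈ₛ (p∘, _ _)) ∙ sym≈ ([∘] _ _ _)

  ⌜wkRen⌝ : (ρ : Ren Σ Γ Δ) → ⌜ wkRen Σ {σ = σ} ρ ⌝R ≈ₛ' ⌜ ρ ⌝R ∘ₛ p
  ⌜wkRen⌝ ε        = sym≈ₛ (εη _)
  ⌜wkRen⌝ (ρ ,ᵣ x) = ,-cong (⌜wkRen⌝ ρ) refl≈ ∙ₛ sym≈ₛ (,∘ _ _ _)

  ⌜idRen⌝ : ⌜ idRen Σ {Γ} ⌝R ≈ₛ' id
  ⌜idRen⌝ {ε}     = sym≈ₛ (εη id)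
  ⌜idRen⌝ {Γ ▹ τ} =
    ,-cong (⌜wkRen⌝ (idRen Σ) ∙ₛ ∘-cong ⌜idRen⌝ refl≈ₛ ∙ₛ idl p) refl≈
    ∙ₛ sym≈ₛ (,η id ∙ₛ ,-cong (idr p) v[id])

  ⌜wk⌝ : ⌜ wk Σ {Γ} {σ} ⌝R ≈ₛ' p
  ⌜wk⌝ = ⌜wkRen⌝ (idRen Σ) ∙ₛ ∘-cong ⌜idRen⌝ refl≈ₛ ∙ₛ idl p

  ⌜∘ᵣ⌝ : (ρ : Ren Σ Γ Δ) (ρ' : Ren Σ Θ Γ) → ⌜ _∘ᵣ_ Σ ρ ρ' ⌝R ≈ₛ' ⌜ ρ ⌝R ∘ₛ ⌜ ρ' ⌝R
  ⌜∘ᵣ⌝ ε        ρ' = sym≈ₛ (εη _)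
  ⌜∘ᵣ⌝ (ρ ,ᵣ x) ρ' = ,-cong (⌜∘ᵣ⌝ ρ ρ') (⌜renVar⌝ ρ' x) ∙ₛ sym≈ₛ (,∘ _ _ _)

  ↓ne-renNe  : (ρ : Ren Σ Δ Γ) (n : Ne Σ Γ τ) → ↓ne Σ (renNe Σ ρ n) ≈' ↓ne Σ n [ ⌜ ρ ⌝R ]
  ↓nf-renNf  : (ρ : Ren Σ Δ Γ) (n : Nf Σ Γ τ) → ↓nf Σ (renNf Σ ρ n) ≈' ↓nf Σ n [ ⌜ ρ ⌝R ]
  ↓nfS-renNfS : (ρ : Ren Σ Δ Γ) (ns : NfS Σ Γ Θ) →
    ↓nfS Σ (renNfS Σ ρ ns) ≈ₛ' ↓nfS Σ ns ∘ₛ ⌜ ρ ⌝R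

  ↓ne-renNe ρ (var x)    = ⌜renVar⌝ ρ x
  ↓ne-renNe ρ (opN o ns) = []-cong refl≈ (↓nfS-renNfS ρ ns) ∙ sym≈ ([∘] _ _ _)
  ↓ne-renNe ρ (appN n m) = app-cong (↓ne-renNe ρ n) (↓nf-renNf ρ m) ∙ sym≈ (app[] _ _ _)
  ↓ne-renNe ρ (fstN n)   = fst-cong (↓ne-renNe ρ n) ∙ sym≈ (fst[] _ _)
  ↓ne-renNe ρ (sndN n)   = snd-cong (↓ne-renNe ρ n) ∙ sym≈ (snd[] _ _)

  ↓nf-renNf ρ (neN n)     = ↓ne-renNe ρ n
  ↓nf-renNf ρ (lamN m)    =
    lam-cong (↓nf-renNf (wkRen Σ ρ ,ᵣ vz) m ∙ []-cong refl≈ (,-cong (⌜wkRen⌝ ρ) refl≈))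
    ∙ sym≈ (lam[] _ _)
  ↓nf-renNf ρ (pairN a b) = pair-cong (↓nf-renNf ρ a) (↓nf-renNf ρ b) ∙ sym≈ (pair[] _ _ _)

  ↓nfS-renNfS ρ ε         = sym≈ₛ (εη _)
  ↓nfS-renNfS ρ (ns ,ₙ n) = ,-cong (↓nfS-renNfS ρ ns) (↓nf-renNf ρ n) ∙ₛ sym≈ₛ (,∘ _ _ _)

  -- The term component of a function value is not constrained: only its Kripke action is.
  Rel : (τ : Ty S) → Tm Σ Γ τ → P Σ τ Γ → Set
  Rel (ι a)       t n       = t ≈' ↓nf Σ n
  Rel (σ ⊗ τ)     t (a , b) = Rel σ (fst t) a × Rel τ (snd t) b
  Rel {Γ} (σ ⇒ τ) t (_ , F) =
    ∀ {Δ} (ρ : Ren Σ Δ Γ) {s a} → Rel σ s a → Rel τ (app (t [ ⌜ ρ ⌝R ]) s) (F ρ a)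

  Rel-resp-≈ : (τ : Ty S) {t t' : Tm Σ Γ τ} {a : P Σ τ Γ} → t ≈' t' → Rel τ t a → Rel τ t' a
  Rel-resp-≈ (ι a)   t≈t' r         = sym≈ t≈t' ∙ r
  Rel-resp-≈ (σ ⊗ τ) t≈t' (r₁ , r₂) =
    Rel-resp-≈ σ (fst-cong t≈t') r₁ , Rel-resp-≈ τ (snd-cong t≈t') r₂
  Rel-resp-≈ (σ ⇒ τ) t≈t' r ρ rs    =
    Rel-resp-≈ τ (app-cong ([]-cong t≈t' refl≈ₛ) refl≈) (r ρ rs)

  Rel-ren : (τ : Ty S) (ρ : Ren Σ Δ Γ) {t : Tm Σ Γ τ} {a : P Σ τ Γ} → Rel τ t a →
    Rel τ (t [ ⌜ ρ ⌝R ]) (renP Σ τ ρ a)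
  Rel-ren (ι a)   ρ {a = n} r     = []-cong r refl≈ₛ ∙ sym≈ (↓nf-renNf ρ n)
  Rel-ren (σ ⊗ τ) ρ {t} (r₁ , r₂) =
    Rel-resp-≈ σ (fst[] t _) (Rel-ren σ ρ r₁) , Rel-resp-≈ τ (snd[] t _) (Rel-ren τ ρ r₂)
  Rel-ren (σ ⇒ τ) ρ {t} r ρ' rs   =
    Rel-resp-≈ τ (app-cong ([]-cong refl≈ (⌜∘ᵣ⌝ ρ ρ') ∙ sym≈ ([∘] t _ _)) refl≈)
      (r (_∘ᵣ_ Σ ρ ρ') rs)

  Rel-reflect : (τ : Ty S) (n : Ne Σ Γ τ) → Rel τ (↓ne Σ n) (reflect Σ τ n)
  Rel-reify   : (τ : Ty S) {t : Tm Σ Γ τ} {a : P Σ τ Γ} → Rel τ t a →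
    t ≈' ↓nf Σ (reify Σ τ a)

  Rel-reflect (ι a)   n = refl≈
  Rel-reflect (σ ⊗ τ) n = Rel-reflect σ (fstN n) , Rel-reflect τ (sndN n)
  Rel-reflect (σ ⇒ τ) n ρ {a = a} r =
    Rel-resp-≈ τ (app-cong (↓ne-renNe ρ n) (sym≈ (Rel-reify σ r)))
      (Rel-reflect τ (appN (renNe Σ ρ n) (reify Σ σ a)))

  Rel-reify (ι a)   r             = r
  Rel-reify (σ ⊗ τ) {t} (r₁ , r₂) = ⊗η t ∙ pair-cong (Rel-reify σ r₁) (Rel-reify τ r₂)
  Rel-reify (σ ⇒ τ) {t} {f} r     = begin
    t                             ≈⟨ ⇒η t ⟩
    lam (app (t [ p ]) v)         ≈⟨ lam-cong (app-cong ([]-cong refl≈ (sym≈ₛ ⌜wk⌝)) refl≈) ⟩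
    lam (app (t [ ⌜ wk Σ ⌝R ]) v) ≈⟨ lam-cong (Rel-reify τ (r (wk Σ) (Rel-reflect σ (var vz)))) ⟩
    ↓nf Σ (reify Σ (σ ⇒ τ) f)     ∎
    where open ≈-Reasoning

  RelC : (Γ : Ctx S) → Sub Σ Δ Γ → PC Σ Γ Δ → Set
  RelC ε       δ γ       = ⊤
  RelC (Γ ▹ τ) δ (γ , a) = RelC Γ (p ∘ₛ δ) γ × Rel τ (v [ δ ]) a

  RelC-resp-≈ₛ : (Γ : Ctx S) {δ δ' : Sub Σ Δ Γ} {γ : PC Σ Γ Δ} → δ ≈ₛ' δ' →
    RelC Γ δ γ → RelC Γ δ' γ
  RelC-resp-≈ₛ ε       δ≈δ' r         = tt
  RelC-resp-≈ₛ (Γ ▹ τ) δ≈δ' (r₁ , r₂) =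
    RelC-resp-≈ₛ Γ (∘-cong refl≈ₛ δ≈δ') r₁ , Rel-resp-≈ τ ([]-cong refl≈ δ≈δ') r₂

  RelC-ren : (Γ : Ctx S) (ρ : Ren Σ Θ Δ) {δ : Sub Σ Δ Γ} {γ : PC Σ Γ Δ} → RelC Γ δ γ →
    RelC Γ (δ ∘ₛ ⌜ ρ ⌝R) (renPC Σ Γ ρ γ)
  RelC-ren ε       ρ r             = tt
  RelC-ren (Γ ▹ τ) ρ {δ} (r₁ , r₂) =
    RelC-resp-≈ₛ Γ (assoc p δ _) (RelC-ren Γ ρ r₁) , Rel-resp-≈ τ ([∘] v δ _) (Rel-ren τ ρ r₂)

  RelC-reifyC : (Γ : Ctx S) {δ : Sub Σ Δ Γ} {γ : PC Σ Γ Δ} → RelC Γ δ γ →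
    δ ≈ₛ' ↓nfS Σ (reifyC Σ Γ γ)
  RelC-reifyC ε       {δ} r         = εη δ
  RelC-reifyC (Γ ▹ τ) {δ} (r₁ , r₂) = ,η δ ∙ₛ ,-cong (RelC-reifyC Γ r₁) (Rel-reify τ r₂)

  RelC-reflectC-renToNe : (ρ : Ren Σ Δ Γ) → RelC Γ ⌜ ρ ⌝R (reflectC Σ Γ (renToNe Σ ρ))
  RelC-reflectC-renToNe ε                    = tt
  RelC-reflectC-renToNe {Γ = Γ ▹ τ} (ρ ,ᵣ x) =
    RelC-resp-≈ₛ Γ (sym≈ₛ (p∘, _ _)) (RelC-reflectC-renToNe ρ) ,
    Rel-resp-≈ τ (sym≈ (v[,] _ _)) (Rel-reflect τ (var x))

  lam-β-ren : (t : Tm Σ (Γ ▹ σ) τ) (δ : Sub Σ Δ Γ) (ρ : Ren Σ Θ Δ) (s : Tm Σ Θ σ) →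
    app (lam t [ δ ] [ ⌜ ρ ⌝R ]) s ≈' t [ (δ ∘ₛ ⌜ ρ ⌝R) ,ₛ s ]
  lam-β-ren t δ ρ s = begin
    app (lam t [ δ ] [ ⌜ ρ ⌝R ]) s               ≈⟨ app-cong ([∘] (lam t) δ _ ∙ lam[] t _) refl≈ ⟩
    app (lam (t [ (δ ∘ₛ ⌜ ρ ⌝R) ∘ₛ p ,ₛ v ])) s  ≈⟨ ⇒β _ s ∙ [∘] t _ _ ⟩
    t [ ((δ ∘ₛ ⌜ ρ ⌝R) ∘ₛ p ,ₛ v) ∘ₛ (id ,ₛ s) ] ≈⟨ []-cong refl≈ extend∘snoc ⟩
    t [ (δ ∘ₛ ⌜ ρ ⌝R) ,ₛ s ]                     ∎
    where
    open ≈-Reasoning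
    extend∘snoc : ((δ ∘ₛ ⌜ ρ ⌝R) ∘ₛ p ,ₛ v) ∘ₛ (id ,ₛ s) ≈ₛ' (δ ∘ₛ ⌜ ρ ⌝R) ,ₛ s
    extend∘snoc =
      ,∘ _ _ _ ∙ₛ ,-cong (assoc _ _ _ ∙ₛ ∘-cong refl≈ₛ (p∘, id s) ∙ₛ idr _) (v[,] id s)

  Rel-eval   : (t : Tm Σ Γ τ) {δ : Sub Σ Δ Γ} {γ : PC Σ Γ Δ} → RelC Γ δ γ →
    Rel τ (t [ δ ]) (eval Σ t γ)
  RelC-evalS : (ξ : Sub Σ Γ Θ) {δ : Sub Σ Δ Γ} {γ : PC Σ Γ Δ} → RelC Γ δ γ →
    RelC Θ (ξ ∘ₛ δ) (evalS Σ ξ γ)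

  Rel-eval v {γ = γ , a} (r₁ , r₂) = r₂
  Rel-eval (op o) {γ = γ} r =
    Rel-resp-≈ (cod o) ([]-cong refl≈ (sym≈ₛ (RelC-reifyC (dom o) r)))
      (Rel-reflect (cod o) (opN o (reifyC Σ (dom o) γ)))
  Rel-eval (t [ ξ ]) {δ} r = Rel-resp-≈ _ (sym≈ ([∘] t ξ δ)) (Rel-eval t (RelC-evalS ξ r))
  Rel-eval {Γ} {σ ⇒ τ} (lam t) {δ} r ρ rs =
    Rel-resp-≈ τ (sym≈ (lam-β-ren t δ ρ _))
      (Rel-eval t (RelC-resp-≈ₛ Γ (sym≈ₛ (p∘, _ _)) (RelC-ren Γ ρ r) ,
                   Rel-resp-≈ σ (sym≈ (v[,] _ _)) rs))
  Rel-eval {τ = τ} (app t s) {δ} r =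
    Rel-resp-≈ τ (app-cong ([]-cong refl≈ ⌜idRen⌝ ∙ [id] _) refl≈ ∙ sym≈ (app[] t s δ))
      (Rel-eval t r (idRen Σ) (Rel-eval s r))
  Rel-eval {τ = σ ⊗ τ} (pair a b) {δ} r =
    Rel-resp-≈ σ (sym≈ (⊗β₁ _ _) ∙ fst-cong (sym≈ (pair[] a b δ))) (Rel-eval a r) ,
    Rel-resp-≈ τ (sym≈ (⊗β₂ _ _) ∙ snd-cong (sym≈ (pair[] a b δ))) (Rel-eval b r)
  Rel-eval {τ = τ} (fst t) {δ} r = Rel-resp-≈ τ (sym≈ (fst[] t δ)) (proj₁ (Rel-eval t r))
  Rel-eval {τ = τ} (snd t) {δ} r = Rel-resp-≈ τ (sym≈ (snd[] t δ)) (proj₂ (Rel-eval t r))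

  RelC-evalS {Θ = Θ} id {δ} r = RelC-resp-≈ₛ Θ (sym≈ₛ (idl δ)) r
  RelC-evalS p {γ = γ , a} (r₁ , r₂) = r₁
  RelC-evalS ⟨⟩ r = tt
  RelC-evalS {Θ = Θ ▹ τ} (ξ ,ₛ t) {δ} r =
    RelC-resp-≈ₛ Θ (∘-cong (sym≈ₛ (p∘, ξ t)) refl≈ₛ ∙ₛ assoc p (ξ ,ₛ t) δ) (RelC-evalS ξ r) ,
    Rel-resp-≈ τ (sym≈ (v[,] _ _) ∙ []-cong refl≈ (sym≈ₛ (,∘ ξ t δ))) (Rel-eval t r)
  RelC-evalS {Θ = Θ} (ξ ∘ₛ ζ) {δ} r =
    RelC-resp-≈ₛ Θ (sym≈ₛ (assoc ξ ζ δ)) (RelC-evalS ξ (RelC-evalS ζ r))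

  ↓nf-nf : (Γ : Ctx S) (τ : Ty S) (t : Tm Σ Γ τ) → ↓nf Σ (nf Σ Γ τ t) ≈' t
  ↓nf-nf Γ τ t = begin
    ↓nf Σ (nf Σ Γ τ t) ≈⟨ Rel-reify τ (Rel-eval t idRelC) ⟨
    t [ id ]           ≈⟨ [id] t ⟩
    t                  ∎
    where
    open ≈-Reasoning
    idRelC : RelC Γ id (reflectC Σ Γ (idNe Σ))
    idRelC = RelC-resp-≈ₛ Γ ⌜idRen⌝ (RelC-reflectC-renToNe (idRen Σ))

mainTheorem4 : (Σ : Signature) (Γ : Ctx (Signature.S Σ)) (τ : Ty (Signature.S Σ))
    (t : Tm Σ Γ τ) → _≈_ Σ (↓nf Σ (nf Σ Γ τ t)) t
mainTheorem4 Σ = Soundness.↓nf-nf Σ
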